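{- Let $\delta>0$ and $\beta>0$ be such that for every $N$ and every bipartite graph $H$ with sides $X,Y$ satisfying $|X|,|Y|\ge N$, there exist $X'\subseteq X$, $Y'\subseteq Y$ with $|X'|,|Y'|\ge \beta N$ such that $(X',Y')$ is a $\delta$-regular pair of $H$. Then for every digraph $G=(V,E)$ there is a partition $V=L\cup R\cup W$ (with $W$ possibly empty) such that $E\cap(L\times R)$ is $\delta$-regular and \[ \min\{|L|,|R|\}\ge \beta|V|/2 . \]
   Context: For a bipartite graph $H$ and disjoint vertex sets $X,Y$, the density is $d_H(X,Y)=|H[X,Y]|/(|X||Y|)$, where $|H[X,Y]|$ is the number of edges of $H$ between $X$ and $Y$. The pair $(X,Y)$ (equivalently the bipartite graph $H[X,Y]$) is $\delta$-regular if $|d_H(X',Y')-d_H(X,Y)|<\delta$ whenever $X'\subseteq X$, $Y'\subseteq Y$, $|X'|>\delta|X|$ and $|Y'|>\delta|Y|$. For a set of arcs $D\subseteq L\times R$ with $L,R$ disjoint, the density is $d_D(L',R')=|D\cap(L'\times R')|/(|L'||R'|)$ and $D$ is $\delta$-regular if $|d_D(L',R')-d_D(L,R)|<\delta$ whenever $L'\subseteq L$, $R'\subseteq R$, $|L'|>\delta|L|$, $|R'|>\delta|R|$. Large numbers (such as $|V|/2$) are treated as integers.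
   Formalization: The parameters δ and β range over the positive rationals. -}

module Defs where

open import Data.Nat as ℕ using (ℕ; zero; suc)
open import Data.Integer using (+_)
open import Data.Rational using (ℚ; 0ℚ; _/_; _-_; _<_; _*_) renaming (∣_∣ to abs)
open import Data.Bool using (Bool; true; false; if_then_else_; _∧_)
open import Data.Fin using (Fin)
open import Data.Fin.Subset using (Subset; _⊆_; ∣_∣)
open import Data.List using (map; allFin)
open import Data.Nat.ListAction using (sum)
open import Data.Vec using (lookup)

toℚ : ℕ → ℚ
toℚ n = + n / 1

count : ∀ {n} → (Fin n → Bool) → ℕ
count {n} f = sum (map (λ i → if f i then 1 else 0) (allFin n))

edgeCount : ∀ {a b} → (Fin a → Fin b → Bool) → Subset a → Subset b → ℕ
edgeCount {a} E S T =
  sum (map (λ i → count (λ j → lookup S i ∧ lookup T j ∧ E i j)) (allFin a))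

-- e / m as a rational, with the convention e / 0 = 0
frac : ℕ → ℕ → ℚ
frac e zero = 0ℚ
frac e (suc m) = + e / suc m

density : ∀ {a b} → (Fin a → Fin b → Bool) → Subset a → Subset b → ℚ
density E S T = frac (edgeCount E S T) (∣ S ∣ ℕ.* ∣ T ∣)

Regular : ∀ {a b} → ℚ → (Fin a → Fin b → Bool) → Subset a → Subset b → Set
Regular δ E S T =
  ∀ (S' : Subset _) (T' : Subset _) → S' ⊆ S → T' ⊆ T →
  δ * toℚ ∣ S ∣ < toℚ ∣ S' ∣ → δ * toℚ ∣ T ∣ < toℚ ∣ T' ∣ →
  abs (density E S' T' - density E S T) < δ

-- Cut V into a first block of n / 2 vertices and a second block of the
-- remaining n ∸ n / 2 ≥ n / 2 vertices, and apply the hypothesis with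
-- N = n / 2 to the bipartite graph H of arcs from the first block to the
-- second.  The regular pair (X', Y') it provides lies in different blocks, so
-- L = X' and R = Y' are disjoint, and E ∩ (L' × R') = H[L', R'] for all
-- L' ⊆ L and R' ⊆ R: densities, hence regularity, are the same for E and H.
module Submission where

open import Defs
open import Data.Nat using (ℕ; _/_)
open import Data.Rational using (ℚ; 0ℚ; _<_; _≤_; _*_)
open import Data.Bool using (Bool)
open import Data.Fin using (Fin)
open import Data.Fin.Subset using (Subset; ∣_∣; _∩_; Empty)
open import Data.Product using (Σ; _×_)

open import Data.Nat using (zero; suc; _+_; _∸_)
open import Data.Nat.Properties
  using (+-identityʳ; *-comm; ≤-refl; m+n≤o⇒m≤o∸n; m+[n∸m]≡n)
open import Data.Nat.DivMod using (m/n*n≤m; m/n≤m)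
open import Data.Nat.ListAction using (sum)
open import Data.Nat.ListAction.Properties using (sum-++)
open import Data.Rational using (_-_) renaming (∣_∣ to abs)
open import Data.Bool using (true; false; _∧_; if_then_else_)
open import Data.Fin using (zero; suc; _↑ˡ_; _↑ʳ_)
open import Data.Fin.Subset using (⊥; _⊆_; _∈_)
open import Data.Fin.Subset.Properties
  using (⊥⊆; ∉⊥; ∣⊥∣≡0; drop-∷-⊆; ⊆-antisym; ∩-zeroˡ; ∩-zeroʳ)
open import Data.Vec using ([]; _∷_; _++_; lookup; here; there)
open import Data.Vec.Properties using (lookup-++ˡ; lookup-++ʳ; lookup-replicate; zipWith-++)
open import Data.List using (map; allFin)
import Data.List as List
open import Data.List.Properties using (map-tabulate; tabulate-cong)
open import Data.Product using (_,_; ∃; ∃₂)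
open import Function using (_∘_)
open import Relation.Binary.PropositionalEquality
  using (_≡_; refl; sym; trans; cong; cong₂; subst; module ≡-Reasoning)

open ≡-Reasoning

private
  variable
    m k n : ℕ

tabulate-↑ : ∀ m {k} {A : Set} (f : Fin (m + k) → A) →
  List.tabulate f ≡ List.tabulate (f ∘ (_↑ˡ k)) List.++ List.tabulate (f ∘ (m ↑ʳ_))
tabulate-↑ zero    f = refl
tabulate-↑ (suc m) f = cong (f zero List.∷_) (tabulate-↑ m (f ∘ suc))

sum-allFin : (f : Fin n → ℕ) → sum (map f (allFin n)) ≡ sum (List.tabulate f)
sum-allFin f = cong sum (map-tabulate (λ i → i) f)

sum-allFin-cong : {f g : Fin n → ℕ} → (∀ i → f i ≡ g i) →
  sum (map f (allFin n)) ≡ sum (map g (allFin n))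
sum-allFin-cong {f = f} {g} f≡g = begin
  sum (map f (allFin _))   ≡⟨ sum-allFin f ⟩
  sum (List.tabulate f)    ≡⟨ cong sum (tabulate-cong f≡g) ⟩
  sum (List.tabulate g)    ≡⟨ sum-allFin g ⟨
  sum (map g (allFin _))   ∎

sum-tabulate-≡0 : {f : Fin n → ℕ} → (∀ i → f i ≡ 0) → sum (List.tabulate f) ≡ 0
sum-tabulate-≡0 {zero}  f≡0 = refl
sum-tabulate-≡0 {suc n} f≡0 = cong₂ _+_ (f≡0 zero) (sum-tabulate-≡0 (f≡0 ∘ suc))

sum-allFin-↑ : ∀ m k (f : Fin (m + k) → ℕ) →
  sum (map f (allFin (m + k))) ≡
  sum (map (f ∘ (_↑ˡ k)) (allFin m)) + sum (map (f ∘ (m ↑ʳ_)) (allFin k))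
sum-allFin-↑ m k f = begin
  sum (map f (allFin (m + k)))
    ≡⟨ sum-allFin f ⟩
  sum (List.tabulate f)
    ≡⟨ cong sum (tabulate-↑ m f) ⟩
  sum (List.tabulate (f ∘ (_↑ˡ k)) List.++ List.tabulate (f ∘ (m ↑ʳ_)))
    ≡⟨ sum-++ (List.tabulate (f ∘ (_↑ˡ k))) _ ⟩
  sum (List.tabulate (f ∘ (_↑ˡ k))) + sum (List.tabulate (f ∘ (m ↑ʳ_)))
    ≡⟨ cong₂ _+_ (sum-allFin (f ∘ (_↑ˡ k))) (sum-allFin (f ∘ (m ↑ʳ_))) ⟨
  sum (map (f ∘ (_↑ˡ k)) (allFin m)) + sum (map (f ∘ (m ↑ʳ_)) (allFin k)) ∎

sum-allFin-↑ˡ : ∀ m k (f : Fin (m + k) → ℕ) → (∀ j → f (m ↑ʳ j) ≡ 0) →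
  sum (map f (allFin (m + k))) ≡ sum (map (f ∘ (_↑ˡ k)) (allFin m))
sum-allFin-↑ˡ m k f right≡0 = begin
  sum (map f (allFin (m + k)))
    ≡⟨ sum-allFin-↑ m k f ⟩
  sum (map (f ∘ (_↑ˡ k)) (allFin m)) + sum (map (f ∘ (m ↑ʳ_)) (allFin k))
    ≡⟨ cong (sum (map (f ∘ (_↑ˡ k)) (allFin m)) +_)
         (trans (sum-allFin (f ∘ (m ↑ʳ_))) (sum-tabulate-≡0 right≡0)) ⟩
  sum (map (f ∘ (_↑ˡ k)) (allFin m)) + 0
    ≡⟨ +-identityʳ _ ⟩
  sum (map (f ∘ (_↑ˡ k)) (allFin m)) ∎

sum-allFin-↑ʳ : ∀ m k (f : Fin (m + k) → ℕ) → (∀ i → f (i ↑ˡ k) ≡ 0) →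
  sum (map f (allFin (m + k))) ≡ sum (map (f ∘ (m ↑ʳ_)) (allFin k))
sum-allFin-↑ʳ m k f left≡0 = begin
  sum (map f (allFin (m + k)))
    ≡⟨ sum-allFin-↑ m k f ⟩
  sum (map (f ∘ (_↑ˡ k)) (allFin m)) + sum (map (f ∘ (m ↑ʳ_)) (allFin k))
    ≡⟨ cong (_+ sum (map (f ∘ (m ↑ʳ_)) (allFin k)))
         (trans (sum-allFin (f ∘ (_↑ˡ k))) (sum-tabulate-≡0 left≡0)) ⟩
  sum (map (f ∘ (m ↑ʳ_)) (allFin k)) ∎

count-cong : {f g : Fin n → Bool} → (∀ i → f i ≡ g i) → count f ≡ count g
count-cong f≡g = sum-allFin-cong (λ i → cong (λ b → if b then 1 else 0) (f≡g i))

count-false : ∀ n → count {n} (λ _ → false) ≡ 0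
count-false n = trans (sum-allFin {n} (λ _ → 0)) (sum-tabulate-≡0 {n} (λ _ → refl))

count-↑ʳ : ∀ m k (f : Fin (m + k) → Bool) → (∀ i → f (i ↑ˡ k) ≡ false) →
  count f ≡ count (f ∘ (m ↑ʳ_))
count-↑ʳ m k f left≡false =
  sum-allFin-↑ʳ m k _ (λ i → cong (λ b → if b then 1 else 0) (left≡false i))

∣++∣ : (A : Subset m) (B : Subset k) → ∣ A ++ B ∣ ≡ ∣ A ∣ + ∣ B ∣
∣++∣ []          B = refl
∣++∣ (true ∷ A)  B = cong suc (∣++∣ A B)
∣++∣ (false ∷ A) B = ∣++∣ A B

∣++⊥∣ : (A : Subset m) → ∣ A ++ ⊥ {k} ∣ ≡ ∣ A ∣
∣++⊥∣ {k = k} A = trans (∣++∣ A ⊥) (trans (cong (∣ A ∣ +_) (∣⊥∣≡0 k)) (+-identityʳ _))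

∣⊥++∣ : (B : Subset k) → ∣ ⊥ {m} ++ B ∣ ≡ ∣ B ∣
∣⊥++∣ {m = m} B = trans (∣++∣ (⊥ {m}) B) (cong (_+ ∣ B ∣) (∣⊥∣≡0 m))

lookup-⊥++-↑ˡ : (B : Subset k) (i : Fin m) → lookup (⊥ ++ B) (i ↑ˡ k) ≡ false
lookup-⊥++-↑ˡ B i = trans (lookup-++ˡ ⊥ B i) (lookup-replicate i false)

lookup-++⊥-↑ʳ : (A : Subset m) (j : Fin k) → lookup (A ++ ⊥) (m ↑ʳ j) ≡ false
lookup-++⊥-↑ʳ A j = trans (lookup-++ʳ A ⊥ j) (lookup-replicate j false)

⊥++⊥ : ∀ m → ⊥ {m} ++ ⊥ {k} ≡ ⊥
⊥++⊥ zero    = refl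
⊥++⊥ (suc m) = cong (false ∷_) (⊥++⊥ m)

++⊥-∩-⊥++ : (A : Subset m) (B : Subset k) → (A ++ ⊥) ∩ (⊥ ++ B) ≡ ⊥
++⊥-∩-⊥++ {m} {k} A B = begin
  (A ++ ⊥) ∩ (⊥ ++ B)   ≡⟨ zipWith-++ _∧_ A ⊥ ⊥ B ⟩
  A ∩ ⊥ ++ ⊥ ∩ B        ≡⟨ cong₂ _++_ (∩-zeroʳ A) (∩-zeroˡ B) ⟩
  ⊥ {m} ++ ⊥ {k}        ≡⟨ ⊥++⊥ m ⟩
  ⊥                     ∎

⊆⊥⇒≡⊥ : {p : Subset n} → p ⊆ ⊥ → p ≡ ⊥
⊆⊥⇒≡⊥ p⊆⊥ = ⊆-antisym p⊆⊥ ⊥⊆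

⊆-++⁻ : (S : Subset (m + k)) (A : Subset m) (B : Subset k) → S ⊆ A ++ B →
  ∃₂ λ A′ B′ → S ≡ A′ ++ B′ × A′ ⊆ A × B′ ⊆ B
⊆-++⁻ {zero} S [] B S⊆B = [] , S , refl , (λ ()) , S⊆B
⊆-++⁻ {suc m} (s ∷ S) (a ∷ A) B s∷S⊆ with ⊆-++⁻ S A B (drop-∷-⊆ s∷S⊆)
... | A′ , B′ , refl , A′⊆A , B′⊆B = s ∷ A′ , B′ , refl , s∷A′⊆a∷A , B′⊆B
  where
  s∷A′⊆a∷A : s ∷ A′ ⊆ a ∷ A
  s∷A′⊆a∷A here with s∷S⊆ here
  ... | here = here
  s∷A′⊆a∷A (there x∈A′) = there (A′⊆A x∈A′)

⊆-++⊥⁻ : {S : Subset (m + k)} (A : Subset m) → S ⊆ A ++ ⊥ →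
  ∃ λ A′ → S ≡ A′ ++ ⊥ × A′ ⊆ A
⊆-++⊥⁻ {S = S} A S⊆ with ⊆-++⁻ S A ⊥ S⊆
... | A′ , Z , refl , A′⊆A , Z⊆⊥ = A′ , cong (A′ ++_) (⊆⊥⇒≡⊥ Z⊆⊥) , A′⊆A

⊆-⊥++⁻ : {T : Subset (m + k)} (B : Subset k) → T ⊆ ⊥ ++ B →
  ∃ λ B′ → T ≡ ⊥ ++ B′ × B′ ⊆ B
⊆-⊥++⁻ {T = T} B T⊆ with ⊆-++⁻ T ⊥ B T⊆
... | Z , B′ , refl , Z⊆⊥ , B′⊆B = B′ , cong (_++ B′) (⊆⊥⇒≡⊥ Z⊆⊥) , B′⊆B

module _ {m k : ℕ} (E : Fin (m + k) → Fin (m + k) → Bool) where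

  crossing : Fin m → Fin k → Bool
  crossing i j = E (i ↑ˡ k) (m ↑ʳ j)

  edgeCount-crossing : (A : Subset m) (B : Subset k) →
    edgeCount E (A ++ ⊥ {k}) (⊥ {m} ++ B) ≡ edgeCount crossing A B
  edgeCount-crossing A B =
    trans (sum-allFin-↑ˡ m k _ row-↑ʳ) (sum-allFin-cong row-↑ˡ)
    where
    row-↑ʳ : ∀ j →
      count (λ x → lookup (A ++ ⊥ {k}) (m ↑ʳ j) ∧ lookup (⊥ {m} ++ B) x ∧ E (m ↑ʳ j) x) ≡ 0
    row-↑ʳ j = trans
      (count-cong (λ x → cong (_∧ (lookup (⊥ {m} ++ B) x ∧ E (m ↑ʳ j) x)) (lookup-++⊥-↑ʳ A j)))
      (count-false (m + k))

    row-↑ˡ : ∀ i →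
      count (λ x → lookup (A ++ ⊥ {k}) (i ↑ˡ k) ∧ lookup (⊥ {m} ++ B) x ∧ E (i ↑ˡ k) x)
        ≡ count (λ j → lookup A i ∧ lookup B j ∧ crossing i j)
    row-↑ˡ i = trans
      (count-cong (λ x → cong (_∧ (lookup (⊥ {m} ++ B) x ∧ E (i ↑ˡ k) x)) (lookup-++ˡ A (⊥ {k}) i)))
      (row (lookup A i))
      where
      row : ∀ a → count (λ x → a ∧ lookup (⊥ {m} ++ B) x ∧ E (i ↑ˡ k) x)
                ≡ count (λ j → a ∧ lookup B j ∧ crossing i j)
      row false = trans (count-false (m + k)) (sym (count-false k))
      row true  = trans
        (count-↑ʳ m k _ (λ x → cong (_∧ E (i ↑ˡ k) (x ↑ˡ k)) (lookup-⊥++-↑ˡ B x)))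
        (count-cong (λ j → cong (_∧ crossing i j) (lookup-++ʳ (⊥ {m}) B j)))

  density-crossing : (A : Subset m) (B : Subset k) →
    density E (A ++ ⊥ {k}) (⊥ {m} ++ B) ≡ density crossing A B
  density-crossing A B =
    cong₂ frac (edgeCount-crossing A B) (cong₂ Data.Nat._*_ (∣++⊥∣ {k = k} A) (∣⊥++∣ {m = m} B))

  Regular-crossing : ∀ {δ X Y} → Regular δ crossing X Y → Regular δ E (X ++ ⊥ {k}) (⊥ {m} ++ Y)
  Regular-crossing {δ} {X} {Y} reg S T S⊆ T⊆ = on-blocks (⊆-++⊥⁻ X S⊆) (⊆-⊥++⁻ Y T⊆)
    where
    -- Transporting by matching on refl, rather than with subst, keeps Agda from
    -- normalising the rational expressions involved.
    sizes : ∀ {s s′ t t′} → s ≡ t → s′ ≡ t′ → δ * toℚ s < toℚ s′ → δ * toℚ t < toℚ t′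
    sizes refl refl big = big

    densities : ∀ {d d₀ e e₀} → d ≡ e → d₀ ≡ e₀ → abs (e - e₀) < δ → abs (d - d₀) < δ
    densities refl refl close = close

    on-blocks : (∃ λ A → S ≡ A ++ ⊥ {k} × A ⊆ X) → (∃ λ B → T ≡ ⊥ {m} ++ B × B ⊆ Y) →
      δ * toℚ ∣ X ++ ⊥ {k} ∣ < toℚ ∣ S ∣ → δ * toℚ ∣ ⊥ {m} ++ Y ∣ < toℚ ∣ T ∣ →
      abs (density E S T - density E (X ++ ⊥ {k}) (⊥ {m} ++ Y)) < δ
    on-blocks (A , refl , A⊆X) (B , refl , B⊆Y) bigS bigT =
      densities (density-crossing A B) (density-crossing X Y)
        (reg A B A⊆X B⊆Y (sizes (∣++⊥∣ {k = k} X) (∣++⊥∣ {k = k} A) bigS)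
                         (sizes (∣⊥++∣ {m = m} Y) (∣⊥++∣ {m = m} B) bigT))

LargeRegularPairs : ℚ → ℚ → Set
LargeRegularPairs δ β =
  ∀ (N a b : ℕ) (H : Fin a → Fin b → Bool) → N Data.Nat.≤ a → N Data.Nat.≤ b →
    Σ (Subset a) λ X' → Σ (Subset b) λ Y' →
      (β * toℚ N ≤ toℚ ∣ X' ∣) × (β * toℚ N ≤ toℚ ∣ Y' ∣) × Regular δ H X' Y'

RegularCut : ℚ → ℚ → ℕ → (Fin n → Fin n → Bool) → Set
RegularCut {n} δ β N E =
  Σ (Subset n) λ L → Σ (Subset n) λ R →
    Empty (L ∩ R) × Regular δ E L R × (β * toℚ N ≤ toℚ ∣ L ∣) × (β * toℚ N ≤ toℚ ∣ R ∣)

regularCut-++ : ∀ {δ β N} → LargeRegularPairs δ β → N Data.Nat.≤ m → N Data.Nat.≤ k →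
  (E : Fin (m + k) → Fin (m + k) → Bool) → RegularCut δ β N E
regularCut-++ {m} {k} {δ} {β} {N} pairs N≤m N≤k E = fromPair (pairs N m k (crossing E) N≤m N≤k)
  where
  large : ∀ {s t} → t ≡ s → β * toℚ N ≤ toℚ s → β * toℚ N ≤ toℚ t
  large refl big = big

  disjoint : (X : Subset m) (Y : Subset k) → Empty ((X ++ ⊥ {k}) ∩ (⊥ {m} ++ Y))
  disjoint X Y (x , x∈) = ∉⊥ (subst (x ∈_) (++⊥-∩-⊥++ X Y) x∈)

  fromPair : (Σ (Subset m) λ X → Σ (Subset k) λ Y →
               (β * toℚ N ≤ toℚ ∣ X ∣) × (β * toℚ N ≤ toℚ ∣ Y ∣) × Regular δ (crossing E) X Y) →
             RegularCut δ β N E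
  fromPair (X , Y , βN≤∣X∣ , βN≤∣Y∣ , reg) =
    X ++ ⊥ , ⊥ ++ Y , disjoint X Y , Regular-crossing E reg ,
    large (∣++⊥∣ {k = k} X) βN≤∣X∣ , large (∣⊥++∣ {m = m} Y) βN≤∣Y∣

half≤rest : ∀ n → n / 2 Data.Nat.≤ n ∸ n / 2
half≤rest n = m+n≤o⇒m≤o∸n (n / 2) (subst (Data.Nat._≤ n) twice-half (m/n*n≤m n 2))
  where
  twice-half : n / 2 Data.Nat.* 2 ≡ n / 2 + n / 2
  twice-half = trans (*-comm (n / 2) 2) (cong (n / 2 +_) (+-identityʳ (n / 2)))

corollary2p2 : (δ β : ℚ) → 0ℚ < δ → 0ℚ < β →
  (∀ (N a b : ℕ) (H : Fin a → Fin b → Bool) → N Data.Nat.≤ a → N Data.Nat.≤ b →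
    Σ (Subset a) λ X' → Σ (Subset b) λ Y' →
      (β * toℚ N ≤ toℚ ∣ X' ∣) × (β * toℚ N ≤ toℚ ∣ Y' ∣) × Regular δ H X' Y') →
  ∀ (n : ℕ) (E : Fin n → Fin n → Bool) →
    Σ (Subset n) λ L → Σ (Subset n) λ R →
      Empty (L ∩ R) × Regular δ E L R ×
      (β * toℚ (n / 2) ≤ toℚ ∣ L ∣) × (β * toℚ (n / 2) ≤ toℚ ∣ R ∣)
corollary2p2 δ β _ _ pairs n =
  subst (λ v → (E : Fin v → Fin v → Bool) → RegularCut δ β (n / 2) E)
    (m+[n∸m]≡n (m/n≤m n 2))
    (regularCut-++ {δ = δ} {β = β} pairs ≤-refl (half≤rest n))
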